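{- For every term $\mathbf{t}$, basis term $\mathbf{b}$, type $T$, unit types $U,U_1,\dots,U_n$, type variables $X_1,\dots,X_n$ and context $\Gamma$: (1) if $\Gamma\vdash\mathbf{t}:T$ then $\Gamma[\vec{U}/\vec{X}]\vdash\mathbf{t}:T[\vec{U}/\vec{X}]$; (2) if $\Gamma,x:U\vdash\mathbf{t}:T$ and $\Gamma\vdash\mathbf{b}:U$, then $\Gamma\vdash\mathbf{t}[\mathbf{b}/x]:T$.
   Context: Lineal terms over a commutative ring $(\mathcal{S},+,\times)$: basis terms $\mathbf{b}::=x\mid\lambda x\,\mathbf{t}$, terms $\mathbf{t}::=\mathbf{b}\mid(\mathbf{t})~\mathbf{r}\mid\mathbf{0}\mid\alpha.\mathbf{t}\mid\mathbf{t}+\mathbf{r}$, modulo AC of $+$; $\mathbf{t}[\mathbf{b}/x]$ is capture-avoiding substitution with $(\alpha.\mathbf{t}+\beta.\mathbf{u})[\mathbf{b}/x]=\alpha.(\mathbf{t}[\mathbf{b}/x])+\beta.(\mathbf{u}[\mathbf{b}/x])$. Scalar type system: types $T::=U\mid\forall X.T\mid\alpha.T\mid\overline{0}$, unit types $U::=X\mid U\to T\mid\forall X.U$; type variables are substituted only by unit types, $(\alpha.T)[U/X]=\alpha.(T[U/X])$, $T[\vec{U}/\vec{X}]$ means $T[U_1/X_1]\cdots[U_n/X_n]$, and $\Gamma[\vec{U}/\vec{X}]$ applies this to every type in $\Gamma$. $\equiv$ is the least congruence with $\alpha.\overline{0}\equiv\overline{0}$, $0.T\equiv\overline{0}$, $1.T\equiv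 T$, $\alpha.(\beta.T)\equiv(\alpha\times\beta).T$, $\forall X.\alpha.T\equiv\alpha.\forall X.T$. Contexts: finite sets of $x:U$ ($U$ unit), each variable once. Rules: $\Gamma,x:U\vdash x:U$; from $\Gamma\vdash\mathbf{t}:T$, $T\equiv S$ infer $\Gamma\vdash\mathbf{t}:S$; from $\Gamma\vdash\mathbf{t}:\alpha.(U\to T)$, $\Gamma\vdash\mathbf{r}:\beta.U$ infer $\Gamma\vdash(\mathbf{t})~\mathbf{r}:(\alpha\times\beta).T$; from $\Gamma,x:U\vdash\mathbf{t}:T$ infer $\Gamma\vdash\lambda x\,\mathbf{t}:U\to T$; from $\Gamma\vdash\mathbf{t}:\forall X.T$ infer $\Gamma\vdash\mathbf{t}:T[U/X]$ ($U$ unit); from $\Gamma\vdash\mathbf{t}:T$ infer $\Gamma\vdash\mathbf{t}:\forall X.T$ if $X$ not free in $\Gamma$; $\Gamma\vdash\mathbf{0}:\overline{0}$; from $\Gamma\vdash\mathbf{t}:\alpha.T$, $\Gamma\vdash\mathbf{r}:\beta.T$ infer $\Gamma\vdash\mathbf{t}+\mathbf{r}:(\alpha+\beta).T$; from $\Gamma\vdash\mathbf{t}:T$ infer $\Gamma\vdash\alpha.\mathbf{t}:\alpha.T$. -}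

module Defs where

open import Algebra.Bundles using (CommutativeRing)
open import Data.Nat using (ℕ; zero; suc; _≡ᵇ_)
open import Data.Bool using (if_then_else_)
open import Data.List using (List; []; _∷_; map)
open import Data.Vec using (Vec; []; _∷_)
open import Level using (_⊔_)

-- Everything is parameterised by the commutative ring of scalars (S,+,×).
-- Term variables and type variables are de Bruijn indices.
module Lineal {c ℓ} (R : CommutativeRing c ℓ) where

  open CommutativeRing R
    using ()
    renaming (Carrier to S; _+_ to _+ˢ_; _*_ to _*ˢ_; 0# to 0ˢ; 1# to 1ˢ; _≈_ to _≈ˢ_)

  data Term : Set c where
    var : ℕ → Term
    ƛ_  : Term → Term
    app : Term → Term → Term
    𝟎   : Term
    _•_ : S → Term → Term
    _⊕_ : Term → Term → Term

  data Basis : Term → Set c where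
    var-basis : ∀ i → Basis (var i)
    ƛ-basis   : ∀ t → Basis (ƛ t)

  data _~_ : Term → Term → Set c where
    ~-refl  : ∀ {t} → t ~ t
    ~-sym   : ∀ {t r} → t ~ r → r ~ t
    ~-trans : ∀ {t r s} → t ~ r → r ~ s → t ~ s
    ~-comm  : ∀ {t r} → (t ⊕ r) ~ (r ⊕ t)
    ~-assoc : ∀ {t r s} → ((t ⊕ r) ⊕ s) ~ (t ⊕ (r ⊕ s))
    ~-ƛ     : ∀ {t t'} → t ~ t' → (ƛ t) ~ (ƛ t')
    ~-app   : ∀ {t t' r r'} → t ~ t' → r ~ r' → app t r ~ app t' r'
    ~-•     : ∀ {α t t'} → t ~ t' → (α • t) ~ (α • t')
    ~-⊕     : ∀ {t t' r r'} → t ~ t' → r ~ r' → (t ⊕ r) ~ (t' ⊕ r')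

  extʳ : (ℕ → ℕ) → ℕ → ℕ
  extʳ ρ zero    = zero
  extʳ ρ (suc i) = suc (ρ i)

  rename : (ℕ → ℕ) → Term → Term
  rename ρ (var i)   = var (ρ i)
  rename ρ (ƛ t)     = ƛ (rename (extʳ ρ) t)
  rename ρ (app t r) = app (rename ρ t) (rename ρ r)
  rename ρ 𝟎         = 𝟎
  rename ρ (α • t)   = α • rename ρ t
  rename ρ (t ⊕ r)   = rename ρ t ⊕ rename ρ r

  exts : (ℕ → Term) → ℕ → Term
  exts σ zero    = var zero
  exts σ (suc i) = rename suc (σ i)

  subst : (ℕ → Term) → Term → Term
  subst σ (var i)   = σ i
  subst σ (ƛ t)     = ƛ (subst (exts σ) t)
  subst σ (app t r) = app (subst σ t) (subst σ r)
  subst σ 𝟎         = 𝟎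
  subst σ (α • t)   = α • subst σ t
  subst σ (t ⊕ r)   = subst σ t ⊕ subst σ r

  -- t[b/x] where x is the most recently bound context variable (index 0)
  _[_]₀ : Term → Term → Term
  t [ b ]₀ = subst σ t
    where
    σ : ℕ → Term
    σ zero    = b
    σ (suc i) = var i

  -- Types (unambiguous presentation of the grammar
  --   T ::= U | ∀X.T | α.T | 0̄ ,  U ::= X | U → T | ∀X.U):
  -- a type is either a unit type, or a non-unit type
  --   N ::= α.T | 0̄ | ∀X.N
  mutual
    data UTy : Set c where
      tvar : ℕ → UTy
      _⇒_  : UTy → Ty → UTy
      ∀ᵘ   : UTy → UTy

    data NTy : Set c where
      _⋆_ : S → Ty → NTy
      0̄   : NTy
      ∀ⁿ  : NTy → NTy

    data Ty : Set c where
      ⌜_⌝ : UTy → Ty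
      ⌞_⌟ : NTy → Ty

  ∀ᵀ : Ty → Ty
  ∀ᵀ ⌜ U ⌝ = ⌜ ∀ᵘ U ⌝
  ∀ᵀ ⌞ N ⌟ = ⌞ ∀ⁿ N ⌟

  _·ᵀ_ : S → Ty → Ty
  α ·ᵀ T = ⌞ α ⋆ T ⌟

  𝟘ᵀ : Ty
  𝟘ᵀ = ⌞ 0̄ ⌟

  mutual
    renU : (ℕ → ℕ) → UTy → UTy
    renU ρ (tvar i) = tvar (ρ i)
    renU ρ (U ⇒ T)  = renU ρ U ⇒ renT ρ T
    renU ρ (∀ᵘ U)   = ∀ᵘ (renU (extʳ ρ) U)

    renN : (ℕ → ℕ) → NTy → NTy
    renN ρ (α ⋆ T) = α ⋆ renT ρ T
    renN ρ 0̄       = 0̄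
    renN ρ (∀ⁿ N)  = ∀ⁿ (renN (extʳ ρ) N)

    renT : (ℕ → ℕ) → Ty → Ty
    renT ρ ⌜ U ⌝ = ⌜ renU ρ U ⌝
    renT ρ ⌞ N ⌟ = ⌞ renN ρ N ⌟

  extsᵀ : (ℕ → UTy) → ℕ → UTy
  extsᵀ σ zero    = tvar zero
  extsᵀ σ (suc i) = renU suc (σ i)

  mutual
    subU : (ℕ → UTy) → UTy → UTy
    subU σ (tvar i) = σ i
    subU σ (U ⇒ T)  = subU σ U ⇒ subT σ T
    subU σ (∀ᵘ U)   = ∀ᵘ (subU (extsᵀ σ) U)

    subN : (ℕ → UTy) → NTy → NTy
    subN σ (α ⋆ T) = α ⋆ subT σ T
    subN σ 0̄       = 0̄
    subN σ (∀ⁿ N)  = ∀ⁿ (subN (extsᵀ σ) N)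

    subT : (ℕ → UTy) → Ty → Ty
    subT σ ⌜ U ⌝ = ⌜ subU σ U ⌝
    subT σ ⌞ N ⌟ = ⌞ subN σ N ⌟

  [_/_] : UTy → ℕ → ℕ → UTy
  [ U / X ] Y = if Y ≡ᵇ X then U else tvar Y

  substsU : ∀ {n} → Vec UTy n → Vec ℕ n → UTy → UTy
  substsU []       []       V = V
  substsU (U ∷ Us) (X ∷ Xs) V = substsU Us Xs (subU [ U / X ] V)

  substsT : ∀ {n} → Vec UTy n → Vec ℕ n → Ty → Ty
  substsT []       []       T = T
  substsT (U ∷ Us) (X ∷ Xs) T = substsT Us Xs (subT [ U / X ] T)

  -- T[U/X] where X is the variable bound by ∀X.T (de Bruijn index 0)
  openT : Ty → UTy → Ty
  openT T U = subT σ T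
    where
    σ : ℕ → UTy
    σ zero    = U
    σ (suc i) = tvar i

  data _≡ᵀ_ : Ty → Ty → Set (c ⊔ ℓ) where
    ≡-refl  : ∀ {T} → T ≡ᵀ T
    ≡-sym   : ∀ {T S} → T ≡ᵀ S → S ≡ᵀ T
    ≡-trans : ∀ {T S V} → T ≡ᵀ S → S ≡ᵀ V → T ≡ᵀ V
    ≡-α0    : ∀ {α} → (α ·ᵀ 𝟘ᵀ) ≡ᵀ 𝟘ᵀ
    ≡-0T    : ∀ {T} → (0ˢ ·ᵀ T) ≡ᵀ 𝟘ᵀ
    ≡-1T    : ∀ {T} → (1ˢ ·ᵀ T) ≡ᵀ T
    ≡-αβ    : ∀ {α β T} → (α ·ᵀ (β ·ᵀ T)) ≡ᵀ ((α *ˢ β) ·ᵀ T)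
    ≡-∀α    : ∀ {α T} → ∀ᵀ (α ·ᵀ T) ≡ᵀ (α ·ᵀ ∀ᵀ T)
    ≡-≈     : ∀ {α β T} → α ≈ˢ β → (α ·ᵀ T) ≡ᵀ (β ·ᵀ T)
    ≡-⇒     : ∀ {U U' T T'} → ⌜ U ⌝ ≡ᵀ ⌜ U' ⌝ → T ≡ᵀ T' → ⌜ U ⇒ T ⌝ ≡ᵀ ⌜ U' ⇒ T' ⌝
    ≡-∀     : ∀ {T T'} → T ≡ᵀ T' → ∀ᵀ T ≡ᵀ ∀ᵀ T'
    ≡-·     : ∀ {α T T'} → T ≡ᵀ T' → (α ·ᵀ T) ≡ᵀ (α ·ᵀ T')

  Ctx : Set c
  Ctx = List UTy

  data _∋_⦂_ : Ctx → ℕ → UTy → Set c where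
    here  : ∀ {Γ U} → (U ∷ Γ) ∋ zero ⦂ U
    there : ∀ {Γ U V i} → Γ ∋ i ⦂ U → (V ∷ Γ) ∋ suc i ⦂ U

  data _⊢_⦂_ : Ctx → Term → Ty → Set (c ⊔ ℓ) where
    ax    : ∀ {Γ i U} → Γ ∋ i ⦂ U → Γ ⊢ var i ⦂ ⌜ U ⌝
    conv  : ∀ {Γ t T S} → Γ ⊢ t ⦂ T → T ≡ᵀ S → Γ ⊢ t ⦂ S
    →E    : ∀ {Γ t r α β U T} → Γ ⊢ t ⦂ (α ·ᵀ ⌜ U ⇒ T ⌝) → Γ ⊢ r ⦂ (β ·ᵀ ⌜ U ⌝)
            → Γ ⊢ app t r ⦂ ((α *ˢ β) ·ᵀ T)
    →I    : ∀ {Γ t U T} → (U ∷ Γ) ⊢ t ⦂ T → Γ ⊢ ƛ t ⦂ ⌜ U ⇒ T ⌝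
    ∀E    : ∀ {Γ t T} (U : UTy) → Γ ⊢ t ⦂ ∀ᵀ T → Γ ⊢ t ⦂ openT T U
    ∀I    : ∀ {Γ t T} → map (renU suc) Γ ⊢ t ⦂ T → Γ ⊢ t ⦂ ∀ᵀ T
    ax0   : ∀ {Γ} → Γ ⊢ 𝟎 ⦂ 𝟘ᵀ
    +I    : ∀ {Γ t r α β T} → Γ ⊢ t ⦂ (α ·ᵀ T) → Γ ⊢ r ⦂ (β ·ᵀ T)
            → Γ ⊢ t ⊕ r ⦂ ((α +ˢ β) ·ᵀ T)
    sI    : ∀ {Γ t α T} → Γ ⊢ t ⦂ T → Γ ⊢ α • t ⦂ (α ·ᵀ T)
    -- terms are considered modulo AC of +
    ac    : ∀ {Γ t t' T} → t ~ t' → Γ ⊢ t ⦂ T → Γ ⊢ t' ⦂ T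

-- (1) Type substitution commutes with ∀ᵀ, with opening a ∀ and with ≡ᵀ (by the
-- composition laws of renaming and substitution), so it transports derivations
-- rule by rule; the n substitutions are performed one after the other.
-- (2) A term substitution whose values are typed in Δ maps derivations in Γ to
-- derivations in Δ.  Under ∀I the context is shifted, and the typings of the
-- values are shifted along by (1).
module Submission where

open import Defs
open import Algebra.Bundles using (CommutativeRing)
open import Data.Nat using (ℕ; zero; suc)
open import Data.List using (_∷_; map)
open import Data.List.Properties using (map-id; map-∘; map-cong)
open import Data.Vec using (Vec; []; _∷_)
open import Data.Product using (Σ-syntax; _×_; _,_)
open import Function using (_∘_)
open import Level using (_⊔_)
open import Relation.Binary.PropositionalEquality as ≡
  using (_≡_; _≗_; refl; cong; cong₂; sym; trans)

module _ {c ℓ} (R : CommutativeRing c ℓ) where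
  open Lineal R

  mutual
    renU-∘ : ∀ {ρ ρ′ π} → ρ ∘ ρ′ ≗ π → ∀ A → renU ρ (renU ρ′ A) ≡ renU π A
    renU-∘ h (tvar i) = cong tvar (h i)
    renU-∘ h (U ⇒ T)  = cong₂ _⇒_ (renU-∘ h U) (renT-∘ h T)
    renU-∘ h (∀ᵘ U)   = cong ∀ᵘ (renU-∘ (extʳ-∘ h) U)

    renN-∘ : ∀ {ρ ρ′ π} → ρ ∘ ρ′ ≗ π → ∀ A → renN ρ (renN ρ′ A) ≡ renN π A
    renN-∘ h (α ⋆ T) = cong (α ⋆_) (renT-∘ h T)
    renN-∘ h 0̄       = refl
    renN-∘ h (∀ⁿ N)  = cong ∀ⁿ (renN-∘ (extʳ-∘ h) N)

    renT-∘ : ∀ {ρ ρ′ π} → ρ ∘ ρ′ ≗ π → ∀ A → renT ρ (renT ρ′ A) ≡ renT π A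
    renT-∘ h ⌜ U ⌝ = cong ⌜_⌝ (renU-∘ h U)
    renT-∘ h ⌞ N ⌟ = cong ⌞_⌟ (renN-∘ h N)

    extʳ-∘ : ∀ {ρ ρ′ π} → ρ ∘ ρ′ ≗ π → extʳ ρ ∘ extʳ ρ′ ≗ extʳ π
    extʳ-∘ h zero    = refl
    extʳ-∘ h (suc i) = cong suc (h i)

  mutual
    subU-renU : ∀ {σ ρ τ} → σ ∘ ρ ≗ τ → ∀ A → subU σ (renU ρ A) ≡ subU τ A
    subU-renU h (tvar i) = h i
    subU-renU h (U ⇒ T)  = cong₂ _⇒_ (subU-renU h U) (subT-renT h T)
    subU-renU h (∀ᵘ U)   = cong ∀ᵘ (subU-renU (extsᵀ-extʳ h) U)

    subN-renN : ∀ {σ ρ τ} → σ ∘ ρ ≗ τ → ∀ A → subN σ (renN ρ A) ≡ subN τ A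
    subN-renN h (α ⋆ T) = cong (α ⋆_) (subT-renT h T)
    subN-renN h 0̄       = refl
    subN-renN h (∀ⁿ N)  = cong ∀ⁿ (subN-renN (extsᵀ-extʳ h) N)

    subT-renT : ∀ {σ ρ τ} → σ ∘ ρ ≗ τ → ∀ A → subT σ (renT ρ A) ≡ subT τ A
    subT-renT h ⌜ U ⌝ = cong ⌜_⌝ (subU-renU h U)
    subT-renT h ⌞ N ⌟ = cong ⌞_⌟ (subN-renN h N)

    extsᵀ-extʳ : ∀ {σ ρ τ} → σ ∘ ρ ≗ τ → extsᵀ σ ∘ extʳ ρ ≗ extsᵀ τ
    extsᵀ-extʳ h zero    = refl
    extsᵀ-extʳ h (suc i) = cong (renU suc) (h i)

  mutual
    renU-subU : ∀ {ρ σ τ} → renU ρ ∘ σ ≗ τ → ∀ A → renU ρ (subU σ A) ≡ subU τ A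
    renU-subU h (tvar i) = h i
    renU-subU h (U ⇒ T)  = cong₂ _⇒_ (renU-subU h U) (renT-subT h T)
    renU-subU h (∀ᵘ U)   = cong ∀ᵘ (renU-subU (extʳ-extsᵀ h) U)

    renN-subN : ∀ {ρ σ τ} → renU ρ ∘ σ ≗ τ → ∀ A → renN ρ (subN σ A) ≡ subN τ A
    renN-subN h (α ⋆ T) = cong (α ⋆_) (renT-subT h T)
    renN-subN h 0̄       = refl
    renN-subN h (∀ⁿ N)  = cong ∀ⁿ (renN-subN (extʳ-extsᵀ h) N)

    renT-subT : ∀ {ρ σ τ} → renU ρ ∘ σ ≗ τ → ∀ A → renT ρ (subT σ A) ≡ subT τ A
    renT-subT h ⌜ U ⌝ = cong ⌜_⌝ (renU-subU h U)
    renT-subT h ⌞ N ⌟ = cong ⌞_⌟ (renN-subN h N)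

    extʳ-extsᵀ : ∀ {ρ σ τ} → renU ρ ∘ σ ≗ τ → renU (extʳ ρ) ∘ extsᵀ σ ≗ extsᵀ τ
    extʳ-extsᵀ h zero        = refl
    extʳ-extsᵀ {ρ} {σ} {τ} h (suc i) = begin
      renU (extʳ ρ) (renU suc (σ i)) ≡⟨ renU-∘ (λ _ → refl) (σ i) ⟩
      renU (suc ∘ ρ) (σ i)           ≡⟨ renU-∘ (λ _ → refl) (σ i) ⟨
      renU suc (renU ρ (σ i))        ≡⟨ cong (renU suc) (h i) ⟩
      renU suc (τ i)                 ∎
      where open ≡.≡-Reasoning

  weaken-subU : ∀ σ U → subU (extsᵀ σ) (renU suc U) ≡ renU suc (subU σ U)
  weaken-subU σ U = trans (subU-renU (λ _ → refl) U) (sym (renU-subU (λ _ → refl) U))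

  mutual
    subU-∘ : ∀ {σ τ π} → subU σ ∘ τ ≗ π → ∀ A → subU σ (subU τ A) ≡ subU π A
    subU-∘ h (tvar i) = h i
    subU-∘ h (U ⇒ T)  = cong₂ _⇒_ (subU-∘ h U) (subT-∘ h T)
    subU-∘ h (∀ᵘ U)   = cong ∀ᵘ (subU-∘ (extsᵀ-∘ h) U)

    subN-∘ : ∀ {σ τ π} → subU σ ∘ τ ≗ π → ∀ A → subN σ (subN τ A) ≡ subN π A
    subN-∘ h (α ⋆ T) = cong (α ⋆_) (subT-∘ h T)
    subN-∘ h 0̄       = refl
    subN-∘ h (∀ⁿ N)  = cong ∀ⁿ (subN-∘ (extsᵀ-∘ h) N)

    subT-∘ : ∀ {σ τ π} → subU σ ∘ τ ≗ π → ∀ A → subT σ (subT τ A) ≡ subT π A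
    subT-∘ h ⌜ U ⌝ = cong ⌜_⌝ (subU-∘ h U)
    subT-∘ h ⌞ N ⌟ = cong ⌞_⌟ (subN-∘ h N)

    extsᵀ-∘ : ∀ {σ τ π} → subU σ ∘ τ ≗ π → subU (extsᵀ σ) ∘ extsᵀ τ ≗ extsᵀ π
    extsᵀ-∘ h zero        = refl
    extsᵀ-∘ {σ} {τ} h (suc i) = trans (weaken-subU σ (τ i)) (cong (renU suc) (h i))

  mutual
    subU-var : ∀ {σ ρ} → σ ≗ tvar ∘ ρ → ∀ A → subU σ A ≡ renU ρ A
    subU-var h (tvar i) = h i
    subU-var h (U ⇒ T)  = cong₂ _⇒_ (subU-var h U) (subT-var h T)
    subU-var h (∀ᵘ U)   = cong ∀ᵘ (subU-var (extsᵀ-var h) U)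

    subN-var : ∀ {σ ρ} → σ ≗ tvar ∘ ρ → ∀ A → subN σ A ≡ renN ρ A
    subN-var h (α ⋆ T) = cong (α ⋆_) (subT-var h T)
    subN-var h 0̄       = refl
    subN-var h (∀ⁿ N)  = cong ∀ⁿ (subN-var (extsᵀ-var h) N)

    subT-var : ∀ {σ ρ} → σ ≗ tvar ∘ ρ → ∀ A → subT σ A ≡ renT ρ A
    subT-var h ⌜ U ⌝ = cong ⌜_⌝ (subU-var h U)
    subT-var h ⌞ N ⌟ = cong ⌞_⌟ (subN-var h N)

    extsᵀ-var : ∀ {σ ρ} → σ ≗ tvar ∘ ρ → extsᵀ σ ≗ tvar ∘ extʳ ρ
    extsᵀ-var h zero    = refl
    extsᵀ-var h (suc i) = cong (renU suc) (h i)

  mutual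
    subU-id : ∀ {σ} → σ ≗ tvar → ∀ A → subU σ A ≡ A
    subU-id h (tvar i) = h i
    subU-id h (U ⇒ T)  = cong₂ _⇒_ (subU-id h U) (subT-id h T)
    subU-id h (∀ᵘ U)   = cong ∀ᵘ (subU-id (extsᵀ-id h) U)

    subN-id : ∀ {σ} → σ ≗ tvar → ∀ A → subN σ A ≡ A
    subN-id h (α ⋆ T) = cong (α ⋆_) (subT-id h T)
    subN-id h 0̄       = refl
    subN-id h (∀ⁿ N)  = cong ∀ⁿ (subN-id (extsᵀ-id h) N)

    subT-id : ∀ {σ} → σ ≗ tvar → ∀ A → subT σ A ≡ A
    subT-id h ⌜ U ⌝ = cong ⌜_⌝ (subU-id h U)
    subT-id h ⌞ N ⌟ = cong ⌞_⌟ (subN-id h N)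

    extsᵀ-id : ∀ {σ} → σ ≗ tvar → extsᵀ σ ≗ tvar
    extsᵀ-id h zero    = refl
    extsᵀ-id h (suc i) = cong (renU suc) (h i)

  subT-∀ᵀ : ∀ σ T → subT σ (∀ᵀ T) ≡ ∀ᵀ (subT (extsᵀ σ) T)
  subT-∀ᵀ σ ⌜ U ⌝ = refl
  subT-∀ᵀ σ ⌞ N ⌟ = refl

  -- Both sides equal T under the substitution sending 0 to subU σ U and i+1 to σ i.
  subT-openT : ∀ σ T U → subT σ (openT T U) ≡ openT (subT (extsᵀ σ) T) (subU σ U)
  subT-openT σ T U =
    trans (subT-∘ {π = π} (λ { zero → refl ; (suc i) → refl }) T)
          (sym (subT-∘ {τ = extsᵀ σ} {π = π}
                  (λ { zero → refl
                     ; (suc i) → trans (subU-renU (λ _ → refl) (σ i)) (subU-id (λ _ → refl) (σ i)) })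
                  T))
    where
    π : ℕ → UTy
    π zero    = subU σ U
    π (suc i) = σ i

  ≡ᵀ-subT : ∀ σ {T S} → T ≡ᵀ S → subT σ T ≡ᵀ subT σ S
  ≡ᵀ-subT σ ≡-refl          = ≡-refl
  ≡ᵀ-subT σ (≡-sym e)       = ≡-sym (≡ᵀ-subT σ e)
  ≡ᵀ-subT σ (≡-trans e e′)  = ≡-trans (≡ᵀ-subT σ e) (≡ᵀ-subT σ e′)
  ≡ᵀ-subT σ ≡-α0            = ≡-α0
  ≡ᵀ-subT σ ≡-0T            = ≡-0T
  ≡ᵀ-subT σ ≡-1T            = ≡-1T
  ≡ᵀ-subT σ ≡-αβ            = ≡-αβ
  ≡ᵀ-subT σ (≡-∀α {T = T}) rewrite subT-∀ᵀ σ T = ≡-∀α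
  ≡ᵀ-subT σ (≡-≈ α≈β)       = ≡-≈ α≈β
  ≡ᵀ-subT σ (≡-⇒ e e′)      = ≡-⇒ (≡ᵀ-subT σ e) (≡ᵀ-subT σ e′)
  ≡ᵀ-subT σ (≡-∀ {T} {T′} e) rewrite subT-∀ᵀ σ T | subT-∀ᵀ σ T′ = ≡-∀ (≡ᵀ-subT (extsᵀ σ) e)
  ≡ᵀ-subT σ (≡-· e)         = ≡-· (≡ᵀ-subT σ e)

  ∋-map : ∀ (f : UTy → UTy) {Γ i U} → Γ ∋ i ⦂ U → map f Γ ∋ i ⦂ f U
  ∋-map f here      = here
  ∋-map f (there x) = there (∋-map f x)

  ∋-map⁻ : ∀ (f : UTy → UTy) Γ {i V} → map f Γ ∋ i ⦂ V → Σ[ U ∈ UTy ] Γ ∋ i ⦂ U × f U ≡ V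
  ∋-map⁻ f (U ∷ Γ) here      = U , here , refl
  ∋-map⁻ f (U ∷ Γ) (there x) with ∋-map⁻ f Γ x
  ... | U′ , y , fU′≡V = U′ , there y , fU′≡V

  retype : ∀ {Γ t T T′} → T ≡ T′ → Γ ⊢ t ⦂ T → Γ ⊢ t ⦂ T′
  retype {Γ} {t} = ≡.subst (λ T → Γ ⊢ t ⦂ T)

  recontext : ∀ {Γ Γ′ t T} → Γ ≡ Γ′ → Γ ⊢ t ⦂ T → Γ′ ⊢ t ⦂ T
  recontext {t = t} {T} = ≡.subst (λ Γ → Γ ⊢ t ⦂ T)

  ⊢-subT : ∀ σ {Γ t T} → Γ ⊢ t ⦂ T → map (subU σ) Γ ⊢ t ⦂ subT σ T
  ⊢-subT σ (ax x)     = ax (∋-map (subU σ) x)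
  ⊢-subT σ (conv d e) = conv (⊢-subT σ d) (≡ᵀ-subT σ e)
  ⊢-subT σ (→E d d′)  = →E (⊢-subT σ d) (⊢-subT σ d′)
  ⊢-subT σ (→I d)     = →I (⊢-subT σ d)
  ⊢-subT σ (∀E {T = T} U d) =
    retype (sym (subT-openT σ T U)) (∀E (subU σ U) (retype (subT-∀ᵀ σ T) (⊢-subT σ d)))
  ⊢-subT σ (∀I {Γ} {T = T} d) =
    retype (sym (subT-∀ᵀ σ T)) (∀I (recontext shift-commutes (⊢-subT (extsᵀ σ) d)))
    where
    shift-commutes : map (subU (extsᵀ σ)) (map (renU suc) Γ) ≡ map (renU suc) (map (subU σ) Γ)
    shift-commutes = trans (sym (map-∘ Γ)) (trans (map-cong (weaken-subU σ) Γ) (map-∘ Γ))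
  ⊢-subT σ ax0        = ax0
  ⊢-subT σ (+I d d′)  = +I (⊢-subT σ d) (⊢-subT σ d′)
  ⊢-subT σ (sI d)     = sI (⊢-subT σ d)
  ⊢-subT σ (ac t~t′ d) = ac t~t′ (⊢-subT σ d)

  ⊢-renT : ∀ ρ {Γ t T} → Γ ⊢ t ⦂ T → map (renU ρ) Γ ⊢ t ⦂ renT ρ T
  ⊢-renT ρ {Γ} {T = T} d =
    recontext (map-cong (subU-var (λ _ → refl)) Γ)
      (retype (subT-var (λ _ → refl) T) (⊢-subT (tvar ∘ ρ) d))

  ⊢-substs : ∀ {n} (Us : Vec UTy n) (Xs : Vec ℕ n) {Γ t T}
           → Γ ⊢ t ⦂ T → map (substsU Us Xs) Γ ⊢ t ⦂ substsT Us Xs T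
  ⊢-substs []       []       {Γ} d = recontext (sym (map-id Γ)) d
  ⊢-substs (U ∷ Us) (X ∷ Xs) {Γ} d =
    recontext (sym (map-∘ Γ)) (⊢-substs Us Xs (⊢-subT [ U / X ] d))

  rename-~ : ∀ ρ {t t′} → t ~ t′ → rename ρ t ~ rename ρ t′
  rename-~ ρ ~-refl          = ~-refl
  rename-~ ρ (~-sym e)       = ~-sym (rename-~ ρ e)
  rename-~ ρ (~-trans e e′)  = ~-trans (rename-~ ρ e) (rename-~ ρ e′)
  rename-~ ρ ~-comm          = ~-comm
  rename-~ ρ ~-assoc         = ~-assoc
  rename-~ ρ (~-ƛ e)         = ~-ƛ (rename-~ (extʳ ρ) e)
  rename-~ ρ (~-app e e′)    = ~-app (rename-~ ρ e) (rename-~ ρ e′)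
  rename-~ ρ (~-• e)         = ~-• (rename-~ ρ e)
  rename-~ ρ (~-⊕ e e′)      = ~-⊕ (rename-~ ρ e) (rename-~ ρ e′)

  subst-~ : ∀ σ {t t′} → t ~ t′ → subst σ t ~ subst σ t′
  subst-~ σ ~-refl           = ~-refl
  subst-~ σ (~-sym e)        = ~-sym (subst-~ σ e)
  subst-~ σ (~-trans e e′)   = ~-trans (subst-~ σ e) (subst-~ σ e′)
  subst-~ σ ~-comm           = ~-comm
  subst-~ σ ~-assoc          = ~-assoc
  subst-~ σ (~-ƛ e)          = ~-ƛ (subst-~ (exts σ) e)
  subst-~ σ (~-app e e′)     = ~-app (subst-~ σ e) (subst-~ σ e′)
  subst-~ σ (~-• e)          = ~-• (subst-~ σ e)
  subst-~ σ (~-⊕ e e′)       = ~-⊕ (subst-~ σ e) (subst-~ σ e′)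

  _⊆[_]_ : Ctx → (ℕ → ℕ) → Ctx → Set c
  Γ ⊆[ ρ ] Δ = ∀ {i U} → Γ ∋ i ⦂ U → Δ ∋ ρ i ⦂ U

  ⊆-ext : ∀ {Γ Δ ρ} U → Γ ⊆[ ρ ] Δ → (U ∷ Γ) ⊆[ extʳ ρ ] (U ∷ Δ)
  ⊆-ext U ρ∶Γ⊆Δ here      = here
  ⊆-ext U ρ∶Γ⊆Δ (there x) = there (ρ∶Γ⊆Δ x)

  ⊆-map : ∀ f {Γ Δ ρ} → Γ ⊆[ ρ ] Δ → map f Γ ⊆[ ρ ] map f Δ
  ⊆-map f {Γ} ρ∶Γ⊆Δ x with ∋-map⁻ f Γ x
  ... | U , y , refl = ∋-map f (ρ∶Γ⊆Δ y)

  ⊢-rename : ∀ {Γ Δ ρ t T} → Γ ⊆[ ρ ] Δ → Γ ⊢ t ⦂ T → Δ ⊢ rename ρ t ⦂ T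
  ⊢-rename ρ∶Γ⊆Δ (ax x)      = ax (ρ∶Γ⊆Δ x)
  ⊢-rename ρ∶Γ⊆Δ (conv d e)  = conv (⊢-rename ρ∶Γ⊆Δ d) e
  ⊢-rename ρ∶Γ⊆Δ (→E d d′)   = →E (⊢-rename ρ∶Γ⊆Δ d) (⊢-rename ρ∶Γ⊆Δ d′)
  ⊢-rename ρ∶Γ⊆Δ (→I {U = U} d) = →I (⊢-rename (⊆-ext U ρ∶Γ⊆Δ) d)
  ⊢-rename ρ∶Γ⊆Δ (∀E U d)    = ∀E U (⊢-rename ρ∶Γ⊆Δ d)
  ⊢-rename ρ∶Γ⊆Δ (∀I d)      = ∀I (⊢-rename (⊆-map (renU suc) ρ∶Γ⊆Δ) d)
  ⊢-rename ρ∶Γ⊆Δ ax0         = ax0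
  ⊢-rename ρ∶Γ⊆Δ (+I d d′)   = +I (⊢-rename ρ∶Γ⊆Δ d) (⊢-rename ρ∶Γ⊆Δ d′)
  ⊢-rename ρ∶Γ⊆Δ (sI d)      = sI (⊢-rename ρ∶Γ⊆Δ d)
  ⊢-rename {ρ = ρ} ρ∶Γ⊆Δ (ac t~t′ d) = ac (rename-~ ρ t~t′) (⊢-rename ρ∶Γ⊆Δ d)

  _⊢ˢ_⦂_ : Ctx → (ℕ → Term) → Ctx → Set (c ⊔ ℓ)
  Δ ⊢ˢ σ ⦂ Γ = ∀ {i U} → Γ ∋ i ⦂ U → Δ ⊢ σ i ⦂ ⌜ U ⌝

  ⊢ˢ-ext : ∀ {Γ Δ σ} U → Δ ⊢ˢ σ ⦂ Γ → (U ∷ Δ) ⊢ˢ exts σ ⦂ (U ∷ Γ)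
  ⊢ˢ-ext U ⊢σ here      = ax here
  ⊢ˢ-ext U ⊢σ (there x) = ⊢-rename there (⊢σ x)

  ⊢ˢ-renU : ∀ ρ {Γ Δ σ} → Δ ⊢ˢ σ ⦂ Γ → map (renU ρ) Δ ⊢ˢ σ ⦂ map (renU ρ) Γ
  ⊢ˢ-renU ρ {Γ} ⊢σ x with ∋-map⁻ (renU ρ) Γ x
  ... | U , y , refl = ⊢-renT ρ (⊢σ y)

  ⊢-subst : ∀ {Γ Δ σ t T} → Δ ⊢ˢ σ ⦂ Γ → Γ ⊢ t ⦂ T → Δ ⊢ subst σ t ⦂ T
  ⊢-subst ⊢σ (ax x)          = ⊢σ x
  ⊢-subst ⊢σ (conv d e)      = conv (⊢-subst ⊢σ d) e
  ⊢-subst ⊢σ (→E d d′)       = →E (⊢-subst ⊢σ d) (⊢-subst ⊢σ d′)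
  ⊢-subst ⊢σ (→I {U = U} d)  = →I (⊢-subst (⊢ˢ-ext U ⊢σ) d)
  ⊢-subst ⊢σ (∀E U d)        = ∀E U (⊢-subst ⊢σ d)
  ⊢-subst ⊢σ (∀I d)          = ∀I (⊢-subst (⊢ˢ-renU suc ⊢σ) d)
  ⊢-subst ⊢σ ax0             = ax0
  ⊢-subst ⊢σ (+I d d′)       = +I (⊢-subst ⊢σ d) (⊢-subst ⊢σ d′)
  ⊢-subst ⊢σ (sI d)          = sI (⊢-subst ⊢σ d)
  ⊢-subst {σ = σ} ⊢σ (ac t~t′ d) = ac (subst-~ σ t~t′) (⊢-subst ⊢σ d)

  ⊢-[]₀ : ∀ {Γ U t b T} → (U ∷ Γ) ⊢ t ⦂ T → Γ ⊢ b ⦂ ⌜ U ⌝ → Γ ⊢ t [ b ]₀ ⦂ T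
  ⊢-[]₀ d ⊢b = ⊢-subst (λ { here → ⊢b ; (there x) → ax x }) d

mainTheorem13 : ∀ {c ℓ} (R : CommutativeRing c ℓ) → let open Lineal R in
    (∀ (n : ℕ) (Γ : Ctx) (t : Term) (T : Ty) (Us : Vec UTy n) (Xs : Vec ℕ n)
      → Γ ⊢ t ⦂ T → map (substsU Us Xs) Γ ⊢ t ⦂ substsT Us Xs T)
    ×
    (∀ (Γ : Ctx) (U : UTy) (t b : Term) (T : Ty)
      → Basis b → (U ∷ Γ) ⊢ t ⦂ T → Γ ⊢ b ⦂ ⌜ U ⌝ → Γ ⊢ t [ b ]₀ ⦂ T)
mainTheorem13 R =
  (λ n Γ t T Us Xs → ⊢-substs R Us Xs) ,
  -- The substitution lemma holds for arbitrary terms b.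
  (λ Γ U t b T _ → ⊢-[]₀ R)
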